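{- Let $G$ be a simplicial clique covered graph (SCCG) and $\mathbb{F}$ a field. Then $wcdim(G,\mathbb{F})=sc(G)$.
   Context: All graphs are finite, simple, connected and undirected. A maximal independent set (MIS) is an independent set not properly contained in another independent set. A weighting $f:V(G)\to\mathbb{F}$ is well-covered if $\sum_{v\in\mathcal{M}}f(v)$ is the same for every MIS $\mathcal{M}$ of $G$; the well-covered weightings form an $\mathbb{F}$-vector space (the well-covered space), whose dimension is $wcdim(G,\mathbb{F})$. A vertex $v$ is simplicial if its closed neighborhood $N[v]$ is a maximal clique. A simplicial clique is a maximal clique containing at least one simplicial vertex; $\mathcal{C}(G)$ is the set of simplicial cliques and $sc(G)=|\mathcal{C}(G)|$. $G$ is a simplicial clique covered graph (SCCG) if $\mathcal{C}(G)\neq\emptyset$ and the union of the simplicial cliques is $V(G)$. -}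

module Defs where

open import Level using (Level; _⊔_) renaming (suc to lsuc)
open import Data.Nat using (ℕ; zero; suc)
open import Data.Fin using (Fin; zero; suc; _≟_)
open import Data.Fin.Subset using (Subset; _∈_; _⊆_)
open import Data.Bool using (Bool; true; false; T; if_then_else_; _∨_)
open import Data.Vec using (lookup; tabulate)
open import Data.Product using (Σ; ∃; _×_; _,_)
open import Relation.Nullary using (¬_)
open import Relation.Nullary.Decidable using (⌊_⌋)
open import Relation.Binary.PropositionalEquality using (_≡_; _≢_)
open import Algebra.Bundles using (CommutativeRing)

record Field (c ℓ : Level) : Set (lsuc (c ⊔ ℓ)) where
  field
    commutativeRing : CommutativeRing c ℓ
  open CommutativeRing commutativeRing public
  field
    1≉0     : ¬ (1# ≈ 0#)
    inverse : ∀ x → ¬ (x ≈ 0#) → ∃ λ y → (x * y) ≈ 1#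

record Graph (n : ℕ) : Set where
  field
    adj      : Fin n → Fin n → Bool
    adj-sym  : ∀ u v → adj u v ≡ adj v u
    adj-irr  : ∀ v → adj v v ≡ false

module _ {n : ℕ} (G : Graph n) where
  open Graph G

  Adj : Fin n → Fin n → Set
  Adj u v = T (adj u v)

  data Reach : Fin n → Fin n → Set where
    here : ∀ {v} → Reach v v
    step : ∀ {u w v} → Adj u w → Reach w v → Reach u v

  Connected : Set
  Connected = ∀ u v → Reach u v

  Independent : Subset n → Set
  Independent S = ∀ u v → u ∈ S → v ∈ S → ¬ Adj u v

  IsMIS : Subset n → Set
  IsMIS S = Independent S × (∀ S′ → Independent S′ → S ⊆ S′ → S′ ⊆ S)

  IsClique : Subset n → Set
  IsClique C = ∀ u v → u ∈ C → v ∈ C → u ≢ v → Adj u v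

  IsMaximalClique : Subset n → Set
  IsMaximalClique C = IsClique C × (∀ C′ → IsClique C′ → C ⊆ C′ → C′ ⊆ C)

  closedNbhd : Fin n → Subset n
  closedNbhd v = tabulate (λ u → ⌊ u ≟ v ⌋ ∨ adj v u)

  IsSimplicial : Fin n → Set
  IsSimplicial v = IsMaximalClique (closedNbhd v)

  IsSimplicialClique : Subset n → Set
  IsSimplicialClique C = IsMaximalClique C × (∃ λ v → v ∈ C × IsSimplicial v)

  IsSCCG : Set
  IsSCCG = (∃ λ C → IsSimplicialClique C)
         × (∀ v → ∃ λ C → IsSimplicialClique C × v ∈ C)

  -- sc(G) = k : cl lists the simplicial cliques of G, each exactly once
  EnumeratesSimplicialCliques : (k : ℕ) → (Fin k → Subset n) → Set
  EnumeratesSimplicialCliques k cl =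
      (∀ i → IsSimplicialClique (cl i))
    × (∀ i j → cl i ≡ cl j → i ≡ j)
    × (∀ C → IsSimplicialClique C → ∃ λ i → cl i ≡ C)

module _ {c ℓ : Level} (F : Field c ℓ) where
  open Field F using (Carrier; _≈_; _+_; _*_; 0#)

  Σᶠ : ∀ {m} → (Fin m → Carrier) → Carrier
  Σᶠ {zero}  g = 0#
  Σᶠ {suc m} g = g zero + Σᶠ (λ i → g (suc i))

  weightOf : ∀ {n} → (Fin n → Carrier) → Subset n → Carrier
  weightOf f S = Σᶠ (λ v → if lookup S v then f v else 0#)

  module _ {n : ℕ} (G : Graph n) where

    IsWellCovered : (Fin n → Carrier) → Set ℓ
    IsWellCovered f = ∀ M M′ → IsMIS G M → IsMIS G M′ → weightOf f M ≈ weightOf f M′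

    -- wcdim(G,F) = k : the well-covered space (a subspace of F^V) has a
    -- basis consisting of k weightings
    WcDimIs : ℕ → Set (c ⊔ ℓ)
    WcDimIs k = Σ (Fin k → Fin n → Carrier) λ b →
        (∀ i → IsWellCovered (b i))
      × (∀ (a : Fin k → Carrier) →
           (∀ v → Σᶠ (λ i → a i * b i v) ≈ 0#) → ∀ i → a i ≈ 0#)
      × (∀ f → IsWellCovered f →
           ∃ λ (a : Fin k → Carrier) → ∀ v → f v ≈ Σᶠ (λ i → a i * b i v))

-- Let C₁,…,C_k be the simplicial cliques of G and choose a simplicial
-- representative sᵢ ∈ Cᵢ.  Since sᵢ is simplicial, Cᵢ = N[sᵢ], so sⱼ ∈ Cᵢ
-- only when i = j.  The basis of the well-covered space is formed by the
-- indicators χᵢ of the cliques Cᵢ: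
--   * every maximal independent set M dominates sᵢ, hence meets N[sᵢ] = Cᵢ,
--     and meets it exactly once because Cᵢ is a clique; so χᵢ has weight 1
--     on every MIS and is well-covered;
--   * (Σ aᵢ χᵢ)(sⱼ) = aⱼ, so the χᵢ are linearly independent;
--   * a well-covered g vanishing at every sⱼ is zero: for a vertex u take an
--     MIS M ∋ u; exchanging u for the representatives of the cliques through
--     u gives another MIS M′, and w(M) − w(M′) = g(u).  Applied to
--     g = f − Σ f(sᵢ) χᵢ this shows that the χᵢ span.

module Submission where

open import Defs
open import Level using (Level)
open import Data.Nat using (ℕ; zero; suc)
open import Data.Fin using (Fin; suc; _≟_; punchIn)
open import Data.Fin.Properties using (any?; punchInᵢ≢i)
open import Data.Fin.Subset using (Subset; _∈_; _∉_; _⊆_; _∪_; ⁅_⁆)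
open import Data.Fin.Subset.Properties
  using (_∈?_; x∈p∪q⁻; x∈p∪q⁺; x∈⁅x⁆; x∈⁅y⁆⇒x≡y; ⊆-antisym)
open import Data.Bool using (Bool; true; false; T; if_then_else_)
open import Data.Bool.Properties using (T-≡; T-∨)
open import Data.Vec using (lookup; tabulate)
open import Data.Vec.Properties using (lookup∘tabulate; []=⇒lookup; lookup⇒[]=)
open import Data.List using (List; []; _∷_; allFin)
open import Data.List.Membership.Propositional using () renaming (_∈_ to _∈ˡ_)
open import Data.List.Membership.Propositional.Properties using (∈-allFin)
open import Data.List.Relation.Unary.Any using (here; there)
open import Data.Product using (∃; _×_; _,_; proj₁; proj₂)
open import Data.Sum as Sum using (_⊎_; inj₁; inj₂)
open import Data.Empty using (⊥-elim)
open import Function using (_∘_; id; Equivalence)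
open import Relation.Unary using (Pred; Decidable)
open import Relation.Nullary using (¬_; Dec; yes; no; ¬?; _×-dec_; _⊎-dec_)
open import Relation.Nullary.Decidable using (⌊_⌋; T?; toWitness; fromWitness)
open import Relation.Binary.PropositionalEquality as ≡ using (_≡_; _≢_; refl; subst)
import Relation.Binary.Reasoning.Setoid as SetoidReasoning
import Algebra.Properties.Group as GroupProperties
import Algebra.Properties.Ring as RingProperties
import Algebra.Properties.Semiring.Sum as SemiringSum

open Equivalence using (to; from)

module _ {n : ℕ} {h : Fin n → Bool} {x : Fin n} where

  ∈-tabulate⁺ : T (h x) → x ∈ tabulate h
  ∈-tabulate⁺ t = lookup⇒[]= x (tabulate h) (≡.trans (lookup∘tabulate h x) (to T-≡ t))

  ∈-tabulate⁻ : x ∈ tabulate h → T (h x)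
  ∈-tabulate⁻ m = from T-≡ (≡.trans (≡.sym (lookup∘tabulate h x)) ([]=⇒lookup m))

subsetOf : ∀ {n p} {P : Pred (Fin n) p} → Decidable P → Subset n
subsetOf P? = tabulate (λ v → ⌊ P? v ⌋)

module _ {n p} {P : Pred (Fin n) p} (P? : Decidable P) {v : Fin n} where

  ∈-subsetOf⁺ : P v → v ∈ subsetOf P?
  ∈-subsetOf⁺ = ∈-tabulate⁺ ∘ fromWitness

  ∈-subsetOf⁻ : v ∈ subsetOf P? → P v
  ∈-subsetOf⁻ = toWitness ∘ ∈-tabulate⁻

module GraphFacts {n : ℕ} (G : Graph n) where
  open Graph G

  adj-sym′ : ∀ {u v} → Adj G u v → Adj G v u
  adj-sym′ {u} {v} = subst T (adj-sym u v)

  adj-irrefl : ∀ {v} → ¬ Adj G v v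
  adj-irrefl {v} = subst T (adj-irr v)

  ∈N[]⁺ : ∀ {v x} → x ≡ v ⊎ Adj G v x → x ∈ closedNbhd G v
  ∈N[]⁺ = ∈-tabulate⁺ ∘ from T-∨ ∘ Sum.map fromWitness id

  clique⊆N[] : ∀ {C v} → IsClique G C → v ∈ C → C ⊆ closedNbhd G v
  clique⊆N[] {C} {v} C-clique v∈C {x} x∈C with x ≟ v
  ... | yes x≡v = ∈N[]⁺ (inj₁ x≡v)
  ... | no  x≢v = ∈N[]⁺ (inj₂ (C-clique v x v∈C x∈C (x≢v ∘ ≡.sym)))

  maximalClique≡N[] : ∀ {C s} → IsMaximalClique G C → IsSimplicial G s → s ∈ C →
                      C ≡ closedNbhd G s
  maximalClique≡N[] {C} {s} (C-clique , C-maximal) (N[s]-clique , _) s∈C =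
    ⊆-antisym C⊆N[s] (C-maximal _ N[s]-clique C⊆N[s])
    where
    C⊆N[s] : C ⊆ closedNbhd G s
    C⊆N[s] = clique⊆N[] C-clique s∈C

  independent∩clique-unique : ∀ {M C x y} → Independent G M → IsClique G C →
                              x ∈ M → x ∈ C → y ∈ M → y ∈ C → y ≡ x
  independent∩clique-unique {x = x} {y} M-ind C-clique x∈M x∈C y∈M y∈C with y ≟ x
  ... | yes y≡x = y≡x
  ... | no  y≢x = ⊥-elim (M-ind y x y∈M x∈M (C-clique y x y∈C x∈C y≢x))

  HasNeighbourIn : Fin n → Subset n → Set
  HasNeighbourIn w S = ∃ λ m → m ∈ S × Adj G w m

  hasNeighbourIn? : ∀ w S → Dec (HasNeighbourIn w S)
  hasNeighbourIn? w S = any? (λ m → (m ∈? S) ×-dec T? (adj w m))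

  Dominates : Subset n → Fin n → Set
  Dominates S w = w ∈ S ⊎ HasNeighbourIn w S

  dominates-mono : ∀ {S S′ w} → S ⊆ S′ → Dominates S w → Dominates S′ w
  dominates-mono S⊆S′ (inj₁ w∈S)           = inj₁ (S⊆S′ w∈S)
  dominates-mono S⊆S′ (inj₂ (m , m∈S , a)) = inj₂ (m , S⊆S′ m∈S , a)

  add-independent : ∀ {S w} → Independent G S → ¬ HasNeighbourIn w S →
                    Independent G (S ∪ ⁅ w ⁆)
  add-independent {S} {w} S-ind free x y x∈ y∈ x~y
    with x∈p∪q⁻ S ⁅ w ⁆ x∈ | x∈p∪q⁻ S ⁅ w ⁆ y∈
  ... | inj₁ x∈S | inj₁ y∈S = S-ind x y x∈S y∈S x~y
  ... | inj₁ x∈S | inj₂ y∈w with x∈⁅y⁆⇒x≡y w y∈w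
  ...   | refl = free (x , x∈S , adj-sym′ x~y)
  add-independent {S} {w} S-ind free x y x∈ y∈ x~y | inj₂ x∈w | inj₁ y∈S
    with x∈⁅y⁆⇒x≡y w x∈w
  ...   | refl = free (y , y∈S , x~y)
  add-independent {S} {w} S-ind free x y x∈ y∈ x~y | inj₂ x∈w | inj₂ y∈w
    with x∈⁅y⁆⇒x≡y w x∈w | x∈⁅y⁆⇒x≡y w y∈w
  ...   | refl | refl = adj-irrefl x~y

  independent-dominating⇒MIS : ∀ {S} → Independent G S → (∀ w → Dominates S w) →
                               IsMIS G S
  independent-dominating⇒MIS {S} S-ind S-dom = S-ind , maximal
    where
    maximal : ∀ S′ → Independent G S′ → S ⊆ S′ → S′ ⊆ S
    maximal S′ S′-ind S⊆S′ {x} x∈S′ with S-dom x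
    ... | inj₁ x∈S           = x∈S
    ... | inj₂ (m , m∈S , a) = ⊥-elim (S′-ind x m x∈S′ (S⊆S′ m∈S) a)

  MIS⇒dominating : ∀ {S} → IsMIS G S → ∀ w → Dominates S w
  MIS⇒dominating {S} (S-ind , S-maximal) w with hasNeighbourIn? w S
  ... | yes nbr  = inj₂ nbr
  ... | no  free = inj₁ (S-maximal (S ∪ ⁅ w ⁆) (add-independent S-ind free)
                                   (x∈p∪q⁺ ∘ inj₁) (x∈p∪q⁺ (inj₂ (x∈⁅x⁆ w))))

  addIfFree : (w : Fin n) (S : Subset n) → Dec (HasNeighbourIn w S) → Subset n
  addIfFree w S (yes _) = S
  addIfFree w S (no  _) = S ∪ ⁅ w ⁆

  greedy : List (Fin n) → Subset n → Subset n
  greedy []       S = S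
  greedy (w ∷ ws) S = greedy ws (addIfFree w S (hasNeighbourIn? w S))

  addIfFree-⊇ : ∀ w S d → S ⊆ addIfFree w S d
  addIfFree-⊇ w S (yes _) = id
  addIfFree-⊇ w S (no  _) = x∈p∪q⁺ ∘ inj₁

  addIfFree-independent : ∀ w S d → Independent G S → Independent G (addIfFree w S d)
  addIfFree-independent w S (yes _)  S-ind = S-ind
  addIfFree-independent w S (no free) S-ind = add-independent S-ind free

  addIfFree-dominates : ∀ w S d → Dominates (addIfFree w S d) w
  addIfFree-dominates w S (yes nbr) = inj₂ nbr
  addIfFree-dominates w S (no  _)   = inj₁ (x∈p∪q⁺ (inj₂ (x∈⁅x⁆ w)))

  greedy-⊇ : ∀ ws S → S ⊆ greedy ws S
  greedy-⊇ []       S = id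
  greedy-⊇ (w ∷ ws) S = greedy-⊇ ws _ ∘ addIfFree-⊇ w S (hasNeighbourIn? w S)

  greedy-independent : ∀ ws S → Independent G S → Independent G (greedy ws S)
  greedy-independent []       S = id
  greedy-independent (w ∷ ws) S =
    greedy-independent ws _ ∘ addIfFree-independent w S (hasNeighbourIn? w S)

  greedy-dominates : ∀ ws S w → w ∈ˡ ws → Dominates (greedy ws S) w
  greedy-dominates (w ∷ ws) S w (here refl) =
    dominates-mono (greedy-⊇ ws _) (addIfFree-dominates w S (hasNeighbourIn? w S))
  greedy-dominates (_ ∷ ws) S w (there w∈ws) = greedy-dominates ws _ w w∈ws

  MIS-through : ∀ u → ∃ λ M → IsMIS G M × u ∈ M
  MIS-through u =
    greedy (allFin n) ⁅ u ⁆ ,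
    independent-dominating⇒MIS
      (greedy-independent (allFin n) ⁅ u ⁆ singleton-independent)
      (λ w → greedy-dominates (allFin n) ⁅ u ⁆ w (∈-allFin w)) ,
    greedy-⊇ (allFin n) ⁅ u ⁆ (x∈⁅x⁆ u)
    where
    singleton-independent : Independent G ⁅ u ⁆
    singleton-independent x y x∈ y∈ x~y with x∈⁅y⁆⇒x≡y u x∈ | x∈⁅y⁆⇒x≡y u y∈
    ... | refl | refl = adj-irrefl x~y

module FiniteSums {c ℓ : Level} (F : Field c ℓ) where
  open Field F renaming (refl to ≈-refl)
  open SetoidReasoning setoid
  open SemiringSum semiring
    using (sum; sum-cong-≋; sum-remove; sum-replicate-zero; ∑-distrib-+; ∑-comm; *-distribˡ-sum)
  open RingProperties ring using (-1*x≈-x)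

  Σᶠ≈sum : ∀ {m} (g : Fin m → Carrier) → Σᶠ F g ≈ sum g
  Σᶠ≈sum {zero}  g = ≈-refl
  Σᶠ≈sum {suc m} g = +-congˡ (Σᶠ≈sum (g ∘ suc))

  Σ-cong : ∀ {m} {g h : Fin m → Carrier} → (∀ i → g i ≈ h i) → Σᶠ F g ≈ Σᶠ F h
  Σ-cong {g = g} {h} g≈h = begin
    Σᶠ F g ≈⟨ Σᶠ≈sum g ⟩
    sum g  ≈⟨ sum-cong-≋ g≈h ⟩
    sum h  ≈⟨ Σᶠ≈sum h ⟨
    Σᶠ F h ∎

  Σ-zero : ∀ {m} {g : Fin m → Carrier} → (∀ i → g i ≈ 0#) → Σᶠ F g ≈ 0#
  Σ-zero {m} {g} g≈0 = trans (Σ-cong g≈0) (trans (Σᶠ≈sum {m} (λ _ → 0#)) (sum-replicate-zero m))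

  Σ-+ : ∀ {m} (g h : Fin m → Carrier) → Σᶠ F (λ i → g i + h i) ≈ Σᶠ F g + Σᶠ F h
  Σ-+ g h = begin
    Σᶠ F (λ i → g i + h i) ≈⟨ Σᶠ≈sum (λ i → g i + h i) ⟩
    sum (λ i → g i + h i)  ≈⟨ ∑-distrib-+ g h ⟩
    sum g + sum h          ≈⟨ +-cong (Σᶠ≈sum g) (Σᶠ≈sum h) ⟨
    Σᶠ F g + Σᶠ F h        ∎

  Σ-*ˡ : ∀ {m} (a : Carrier) (g : Fin m → Carrier) → Σᶠ F (λ i → a * g i) ≈ a * Σᶠ F g
  Σ-*ˡ a g = begin
    Σᶠ F (λ i → a * g i) ≈⟨ Σᶠ≈sum (λ i → a * g i) ⟩
    sum (λ i → a * g i)  ≈⟨ *-distribˡ-sum a g ⟨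
    a * sum g            ≈⟨ *-congˡ (Σᶠ≈sum g) ⟨
    a * Σᶠ F g           ∎

  Σ-- : ∀ {m} (g h : Fin m → Carrier) → Σᶠ F (λ i → g i - h i) ≈ Σᶠ F g - Σᶠ F h
  Σ-- g h = begin
    Σᶠ F (λ i → g i - h i)          ≈⟨ Σ-+ g (λ i → - h i) ⟩
    Σᶠ F g + Σᶠ F (λ i → - h i)     ≈⟨ +-congˡ (Σ-cong (λ i → sym (-1*x≈-x (h i)))) ⟩
    Σᶠ F g + Σᶠ F (λ i → - 1# * h i) ≈⟨ +-congˡ (Σ-*ˡ (- 1#) h) ⟩
    Σᶠ F g + - 1# * Σᶠ F h          ≈⟨ +-congˡ (-1*x≈-x _) ⟩
    Σᶠ F g - Σᶠ F h                 ∎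

  Σ-comm : ∀ {m p} (h : Fin m → Fin p → Carrier) →
           Σᶠ F (λ i → Σᶠ F (h i)) ≈ Σᶠ F (λ j → Σᶠ F (λ i → h i j))
  Σ-comm h = begin
    Σᶠ F (λ i → Σᶠ F (h i))            ≈⟨ Σᶠ≈sum (λ i → Σᶠ F (h i)) ⟩
    sum (λ i → Σᶠ F (h i))             ≈⟨ sum-cong-≋ (λ i → Σᶠ≈sum (h i)) ⟩
    sum (λ i → sum (h i))              ≈⟨ ∑-comm h ⟩
    sum (λ j → sum (λ i → h i j))      ≈⟨ sum-cong-≋ (λ j → Σᶠ≈sum (λ i → h i j)) ⟨
    sum (λ j → Σᶠ F (λ i → h i j))     ≈⟨ Σᶠ≈sum (λ j → Σᶠ F (λ i → h i j)) ⟨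
    Σᶠ F (λ j → Σᶠ F (λ i → h i j))    ∎

  Σ-single : ∀ {m} {g : Fin m → Carrier} (x : Fin m) → (∀ i → i ≢ x → g i ≈ 0#) →
             Σᶠ F g ≈ g x
  Σ-single {suc m} {g} x off = begin
    Σᶠ F g                         ≈⟨ Σᶠ≈sum g ⟩
    sum g                          ≈⟨ sum-remove {i = x} g ⟩
    g x + sum (g ∘ punchIn x)      ≈⟨ +-congˡ (Σᶠ≈sum (g ∘ punchIn x)) ⟨
    g x + Σᶠ F (g ∘ punchIn x)     ≈⟨ +-congˡ (Σ-zero (λ j → off _ (punchInᵢ≢i x j))) ⟩
    g x + 0#                       ≈⟨ +-identityʳ (g x) ⟩
    g x                            ∎

module Weights {c ℓ : Level} (F : Field c ℓ) {n : ℕ} (G : Graph n) where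
  open Field F renaming (refl to ≈-refl)
  open FiniteSums F
  open GraphFacts G using (independent∩clique-unique)
  open GroupProperties +-group using (x≈y⇒x∙y⁻¹≈ε)

  contribution : (Fin n → Carrier) → Subset n → Fin n → Carrier
  contribution f S v = if lookup S v then f v else 0#

  contribution-∈ : ∀ f {S v} → v ∈ S → contribution f S v ≡ f v
  contribution-∈ f v∈S rewrite []=⇒lookup v∈S = refl

  contribution-∉ : ∀ f {S v} → v ∉ S → contribution f S v ≡ 0#
  contribution-∉ f {S} {v} v∉S with lookup S v in e
  ... | true  = ⊥-elim (v∉S (lookup⇒[]= v S e))
  ... | false = refl

  indicator : Subset n → Fin n → Carrier
  indicator = contribution (λ _ → 1#)

  weight-indicator : ∀ {C M x} → IsClique G C → Independent G M → x ∈ M → x ∈ C →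
                     weightOf F (indicator C) M ≈ 1#
  weight-indicator {C} {M} {x} C-clique M-ind x∈M x∈C =
    trans (Σ-single x off)
          (reflexive (≡.trans (contribution-∈ (indicator C) x∈M) (contribution-∈ (λ _ → 1#) x∈C)))
    where
    off : ∀ v → v ≢ x → contribution (indicator C) M v ≈ 0#
    off v v≢x with v ∈? M | v ∈? C
    ... | no v∉M | _     = reflexive (contribution-∉ (indicator C) v∉M)
    ... | yes v∈M | no v∉C =
      reflexive (≡.trans (contribution-∈ (indicator C) v∈M) (contribution-∉ (λ _ → 1#) v∉C))
    ... | yes v∈M | yes v∈C =
      ⊥-elim (v≢x (independent∩clique-unique M-ind C-clique x∈M x∈C v∈M v∈C))

  weight-combination : ∀ {k} (a : Fin k → Carrier) (b : Fin k → Fin n → Carrier) S →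
    weightOf F (λ v → Σᶠ F (λ i → a i * b i v)) S ≈ Σᶠ F (λ i → a i * weightOf F (b i) S)
  weight-combination a b S =
    trans (Σ-cong pointwise)
          (trans (Σ-comm (λ v i → a i * contribution (b i) S v))
                 (Σ-cong (λ i → Σ-*ˡ (a i) (contribution (b i) S))))
    where
    pointwise : ∀ v → contribution (λ v → Σᶠ F (λ i → a i * b i v)) S v
                    ≈ Σᶠ F (λ i → a i * contribution (b i) S v)
    pointwise v with lookup S v
    ... | true  = ≈-refl
    ... | false = sym (Σ-zero (λ i → zeroʳ (a i)))

  weight-difference : ∀ f h S →
    weightOf F (λ v → f v - h v) S ≈ weightOf F f S - weightOf F h S
  weight-difference f h S = trans (Σ-cong pointwise) (Σ-- (contribution f S) (contribution h S))
    where
    pointwise : ∀ v → contribution (λ v → f v - h v) S v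
                    ≈ contribution f S v - contribution h S v
    pointwise v with lookup S v
    ... | true  = ≈-refl
    ... | false = sym (-‿inverseʳ 0#)

  weight-difference-at : ∀ g M M′ u →
    (∀ v → v ≢ u → contribution g M v ≈ contribution g M′ v) →
    weightOf F g M - weightOf F g M′ ≈ contribution g M u - contribution g M′ u
  weight-difference-at g M M′ u agree =
    trans (sym (Σ-- (contribution g M) (contribution g M′)))
          (Σ-single u (λ v v≢u → x≈y⇒x∙y⁻¹≈ε (agree v v≢u)))

  wellCovered-combination : ∀ {k} (a : Fin k → Carrier) (b : Fin k → Fin n → Carrier) →
    (∀ i → IsWellCovered F G (b i)) → IsWellCovered F G (λ v → Σᶠ F (λ i → a i * b i v))
  wellCovered-combination a b b-wc M M′ M-mis M′-mis =
    trans (weight-combination a b M)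
          (trans (Σ-cong (λ i → *-congˡ (b-wc i M M′ M-mis M′-mis)))
                 (sym (weight-combination a b M′)))

  wellCovered-difference : ∀ {f h} → IsWellCovered F G f → IsWellCovered F G h →
                           IsWellCovered F G (λ v → f v - h v)
  wellCovered-difference {f} {h} f-wc h-wc M M′ M-mis M′-mis =
    trans (weight-difference f h M)
          (trans (+-cong (f-wc M M′ M-mis M′-mis) (-‿cong (h-wc M M′ M-mis M′-mis)))
                 (sym (weight-difference f h M′)))

module SimplicialCliqueCover {n : ℕ} (G : Graph n) (sccg : IsSCCG G)
    (k : ℕ) (cl : Fin k → Subset n) (enum : EnumeratesSimplicialCliques G k cl) where
  open GraphFacts G

  private
    simplicial : ∀ i → IsSimplicialClique G (cl i)
    simplicial = proj₁ enum

    cl-injective : ∀ i j → cl i ≡ cl j → i ≡ j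
    cl-injective = proj₁ (proj₂ enum)

    cl-complete : ∀ C → IsSimplicialClique G C → ∃ λ i → cl i ≡ C
    cl-complete = proj₂ (proj₂ enum)

    cl-maximal : ∀ i → IsMaximalClique G (cl i)
    cl-maximal i = proj₁ (simplicial i)

  rep : Fin k → Fin n
  rep i = proj₁ (proj₂ (simplicial i))

  rep∈cl : ∀ i → rep i ∈ cl i
  rep∈cl i = proj₁ (proj₂ (proj₂ (simplicial i)))

  rep-simplicial : ∀ i → IsSimplicial G (rep i)
  rep-simplicial i = proj₂ (proj₂ (proj₂ (simplicial i)))

  cl-clique : ∀ i → IsClique G (cl i)
  cl-clique i = proj₁ (cl-maximal i)

  cl≡N[rep] : ∀ i → cl i ≡ closedNbhd G (rep i)
  cl≡N[rep] i = maximalClique≡N[] (cl-maximal i) (rep-simplicial i) (rep∈cl i)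

  -- The representative of Cⱼ lies in no other simplicial clique: Cᵢ ∋ sⱼ forces Cᵢ = N[sⱼ] = Cⱼ.
  rep-private : ∀ {i j} → rep j ∈ cl i → i ≡ j
  rep-private {i} {j} repⱼ∈clᵢ =
    cl-injective i j
      (≡.trans (maximalClique≡N[] (cl-maximal i) (rep-simplicial j) repⱼ∈clᵢ) (≡.sym (cl≡N[rep] j)))

  neighbour-of-rep : ∀ {i x} → Adj G x (rep i) → x ∈ cl i
  neighbour-of-rep {i} x~rep =
    subst (_ ∈_) (≡.sym (cl≡N[rep] i)) (∈N[]⁺ (inj₂ (adj-sym′ x~rep)))

  covered : ∀ v → ∃ λ i → v ∈ cl i
  covered v with proj₂ sccg v
  ... | C , C-simplicial , v∈C with cl-complete C C-simplicial
  ...   | i , clᵢ≡C = i , subst (v ∈_) (≡.sym clᵢ≡C) v∈C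

  MIS-meets : ∀ {M} → IsMIS G M → ∀ i → ∃ λ x → x ∈ M × x ∈ cl i
  MIS-meets M-mis i with MIS⇒dominating M-mis (rep i)
  ... | inj₁ rep∈M           = rep i , rep∈M , rep∈cl i
  ... | inj₂ (m , m∈M , rep~m) = m , m∈M , neighbour-of-rep (adj-sym′ rep~m)

  meets-all⇒MIS : ∀ {S} → Independent G S → (∀ i → ∃ λ y → y ∈ S × y ∈ cl i) → IsMIS G S
  meets-all⇒MIS {S} S-ind meets = independent-dominating⇒MIS S-ind dominating
    where
    dominating : ∀ w → Dominates S w
    dominating w with w ∈? S
    ... | yes w∈S = inj₁ w∈S
    ... | no  w∉S with covered w
    ...   | i , w∈clᵢ with meets i
    ...     | y , y∈S , y∈clᵢ =
      inj₂ (y , y∈S , cl-clique i w y w∈clᵢ y∈clᵢ (λ w≡y → w∉S (subst (_∈ S) (≡.sym w≡y) y∈S)))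

  -- Exchange u for the representatives of the simplicial cliques containing u.
  ExchangeMember : Subset n → Fin n → Fin n → Set
  ExchangeMember M u v = (v ∈ M × v ≢ u) ⊎ (∃ λ i → v ≡ rep i × u ∈ cl i)

  exchange : Subset n → Fin n → Subset n
  exchange M u = subsetOf (λ v → (v ∈? M ×-dec ¬? (v ≟ u))
                                 ⊎-dec any? (λ i → (v ≟ rep i) ×-dec (u ∈? cl i)))

  ∈-exchange⁺ : ∀ {M u v} → ExchangeMember M u v → v ∈ exchange M u
  ∈-exchange⁺ = ∈-subsetOf⁺ _

  ∈-exchange⁻ : ∀ {M u v} → v ∈ exchange M u → ExchangeMember M u v
  ∈-exchange⁻ = ∈-subsetOf⁻ _

  -- A kept vertex x ≠ u adjacent to sⱼ would lie in Cⱼ together with u.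
  kept-not-adjacent-to-new : ∀ {M u x j} → Independent G M → u ∈ M → x ∈ M → x ≢ u →
                             u ∈ cl j → ¬ Adj G x (rep j)
  kept-not-adjacent-to-new {u = u} {x} {j} M-ind u∈M x∈M x≢u u∈clⱼ x~rep =
    M-ind x u x∈M u∈M (cl-clique j x u (neighbour-of-rep x~rep) u∈clⱼ x≢u)

  exchange-independent : ∀ {M u} → Independent G M → u ∈ M → Independent G (exchange M u)
  exchange-independent {M} {u} M-ind u∈M x y x∈ y∈ x~y
    with ∈-exchange⁻ {M} {u} x∈ | ∈-exchange⁻ {M} {u} y∈
  ... | inj₁ (x∈M , _)   | inj₁ (y∈M , _)   = M-ind x y x∈M y∈M x~y
  ... | inj₁ (x∈M , x≢u) | inj₂ (j , refl , u∈clⱼ) =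
    kept-not-adjacent-to-new M-ind u∈M x∈M x≢u u∈clⱼ x~y
  ... | inj₂ (i , refl , u∈clᵢ) | inj₁ (y∈M , y≢u) =
    kept-not-adjacent-to-new M-ind u∈M y∈M y≢u u∈clᵢ (adj-sym′ x~y)
  ... | inj₂ (i , refl , _) | inj₂ (j , refl , _) with rep-private {j} {i} (neighbour-of-rep x~y)
  ...   | refl = adj-irrefl x~y

  exchange-meets : ∀ {M u} → IsMIS G M → ∀ i → ∃ λ y → y ∈ exchange M u × y ∈ cl i
  exchange-meets {M} {u} M-mis i with MIS-meets M-mis i
  ... | x , x∈M , x∈clᵢ with x ≟ u
  ...   | yes refl = rep i , ∈-exchange⁺ (inj₂ (i , refl , x∈clᵢ)) , rep∈cl i
  ...   | no  x≢u  = x , ∈-exchange⁺ (inj₁ (x∈M , x≢u)) , x∈clᵢ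

  exchange-MIS : ∀ {M u} → IsMIS G M → u ∈ M → IsMIS G (exchange M u)
  exchange-MIS M-mis u∈M =
    meets-all⇒MIS (exchange-independent (proj₁ M-mis) u∈M) (exchange-meets M-mis)

module SimplicialBasis {c ℓ : Level} (F : Field c ℓ) {n : ℕ} (G : Graph n) (sccg : IsSCCG G)
    (k : ℕ) (cl : Fin k → Subset n) (enum : EnumeratesSimplicialCliques G k cl) where
  open Field F renaming (refl to ≈-refl)
  open FiniteSums F
  open Weights F G
  open GraphFacts G using (MIS-through)
  open GroupProperties +-group using (x∙y⁻¹≈ε⇒x≈y; x≈y⇒x∙y⁻¹≈ε)
  open SimplicialCliqueCover G sccg k cl enum

  χ : Fin k → Fin n → Carrier
  χ i = indicator (cl i)

  combination : (Fin k → Carrier) → Fin n → Carrier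
  combination a v = Σᶠ F (λ i → a i * χ i v)

  χ-wellCovered : ∀ i → IsWellCovered F G (χ i)
  χ-wellCovered i M M′ M-mis M′-mis = trans (weight-one M-mis) (sym (weight-one M′-mis))
    where
    weight-one : ∀ {M} → IsMIS G M → weightOf F (χ i) M ≈ 1#
    weight-one M-mis with MIS-meets M-mis i
    ... | x , x∈M , x∈clᵢ = weight-indicator (cl-clique i) (proj₁ M-mis) x∈M x∈clᵢ

  combination-at-rep : ∀ a j → combination a (rep j) ≈ a j
  combination-at-rep a j =
    trans (Σ-single j off)
          (trans (*-congˡ (reflexive (contribution-∈ (λ _ → 1#) (rep∈cl j)))) (*-identityʳ (a j)))
    where
    off : ∀ i → i ≢ j → a i * χ i (rep j) ≈ 0#
    off i i≢j = trans (*-congˡ (reflexive (contribution-∉ (λ _ → 1#) (i≢j ∘ rep-private))))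
                      (zeroʳ (a i))

  wellCovered-vanishing : ∀ g → IsWellCovered F G g → (∀ j → g (rep j) ≈ 0#) → ∀ u → g u ≈ 0#
  wellCovered-vanishing g g-wc g-rep≈0 u with MIS-through u
  ... | M , M-mis , u∈M = x∙y⁻¹≈ε⇒x≈y _ _ (begin
    g u - 0#                                 ≈⟨ +-cong (reflexive (contribution-∈ g u∈M))
                                                       (-‿cong u-contribution′≈0) ⟨
    contribution g M u - contribution g M′ u ≈⟨ weight-difference-at g M M′ u agree ⟨
    weightOf F g M - weightOf F g M′         ≈⟨ x≈y⇒x∙y⁻¹≈ε (g-wc M M′ M-mis M′-mis) ⟩
    0#                                       ∎)
    where
    open SetoidReasoning setoid
    M′ = exchange M u

    M′-mis : IsMIS G M′
    M′-mis = exchange-MIS M-mis u∈M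

    -- Apart from the vertices kept from M, M′ holds only representatives, where g vanishes.
    unkept-contribution≈0 : ∀ {v} → ¬ (v ∈ M × v ≢ u) → contribution g M′ v ≈ 0#
    unkept-contribution≈0 {v} unkept with v ∈? M′
    ... | no  v∉M′ = reflexive (contribution-∉ g v∉M′)
    ... | yes v∈M′ with ∈-exchange⁻ v∈M′
    ...   | inj₁ kept           = ⊥-elim (unkept kept)
    ...   | inj₂ (i , refl , _) = trans (reflexive (contribution-∈ g v∈M′)) (g-rep≈0 i)

    agree : ∀ v → v ≢ u → contribution g M v ≈ contribution g M′ v
    agree v v≢u with v ∈? M
    ... | yes v∈M = reflexive (≡.trans (contribution-∈ g v∈M)
                      (≡.sym (contribution-∈ g (∈-exchange⁺ (inj₁ (v∈M , v≢u))))))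
    ... | no  v∉M =
      trans (reflexive (contribution-∉ g v∉M)) (sym (unkept-contribution≈0 (v∉M ∘ proj₁)))

    u-contribution′≈0 : contribution g M′ u ≈ 0#
    u-contribution′≈0 = unkept-contribution≈0 (λ (_ , u≢u) → u≢u refl)

  χ-independent : ∀ a → (∀ v → combination a v ≈ 0#) → ∀ i → a i ≈ 0#
  χ-independent a a-trivial j = trans (sym (combination-at-rep a j)) (a-trivial (rep j))

  χ-spanning : ∀ f → IsWellCovered F G f →
               ∃ λ (a : Fin k → Carrier) → ∀ v → f v ≈ combination a v
  χ-spanning f f-wc =
    a , λ v → x∙y⁻¹≈ε⇒x≈y _ _ (wellCovered-vanishing residual residual-wc residual-rep v)
    where
    a : Fin k → Carrier
    a i = f (rep i)

    residual : Fin n → Carrier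
    residual v = f v - combination a v

    residual-wc : IsWellCovered F G residual
    residual-wc = wellCovered-difference f-wc (wellCovered-combination a χ χ-wellCovered)

    residual-rep : ∀ j → residual (rep j) ≈ 0#
    residual-rep j = x≈y⇒x∙y⁻¹≈ε (sym (combination-at-rep a j))

-- The indicators χᵢ witness wcdim(G, F) = k.
mainTheorem4 : ∀ {c ℓ : Level} (F : Field c ℓ) {n : ℕ} (G : Graph n) →
    Connected G → IsSCCG G →
    (k : ℕ) (cl : Fin k → Subset n) → EnumeratesSimplicialCliques G k cl →
    WcDimIs F G k
mainTheorem4 F G _ sccg k cl enum = χ , χ-wellCovered , χ-independent , χ-spanning
  where open SimplicialBasis F G sccg k cl enum
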